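{- Let $r$ be an integer with $1\le r\le 3$, and let $m,n$ be positive integers. Let $K_{m,n}$ be the complete bipartite graph with partite classes $X$ and $Y$, $|X|=m$, $|Y|=n$. Then in every coloring of the edges of $K_{m,n}$ with $r$ colors there is a monochromatic component $H$ such that $|V(H)\cap X|\ge m/r$ and $|V(H)\cap Y|\ge n/r$.
   Context: An $r$-coloring of the edges of a graph assigns to each edge one of $r$ colors (no properness condition). A monochromatic component of color $i$ is a connected component of the spanning subgraph whose edges are exactly the edges of color $i$. -}

module Defs where

open import Data.Nat using (ℕ)
open import Data.Fin using (Fin)
open import Data.Sum using (_⊎_; inj₁; inj₂)
open import Relation.Binary.PropositionalEquality using (_≡_)
open import Relation.Binary.Construct.Closure.ReflexiveTransitive using (Star)

-- Vertices of K_{m,n}: inj₁ x for x ∈ X = Fin m, inj₂ y for y ∈ Y = Fin n.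
Vertex : ℕ → ℕ → Set
Vertex m n = Fin m ⊎ Fin n

Coloring : ℕ → ℕ → ℕ → Set
Coloring r m n = Fin m → Fin n → Fin r

data Adj {r m n : ℕ} (c : Coloring r m n) (i : Fin r) : Vertex m n → Vertex m n → Set where
  xy : ∀ x y → c x y ≡ i → Adj c i (inj₁ x) (inj₂ y)
  yx : ∀ x y → c x y ≡ i → Adj c i (inj₂ y) (inj₁ x)

SameComp : {r m n : ℕ} → Coloring r m n → Fin r → Vertex m n → Vertex m n → Set
SameComp c i = Star (Adj c i)

-- Two general facts carry the proof.
--  * Pigeonhole ('large-class', 'large-fibre'): if r classes cover Fin N, one of them
--    has at least N/r elements.
--  * Anchored sets ('anchored'): if P ⊆ X has |P| ≥ m/r and for every colour ℓ except
--    one colour u some y_ℓ ∈ Y is joined to all of P in colour ℓ, then each y ∈ Y is hit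
--    from P in some colour ℓ ≢ u or only in colour u; a class of size ≥ n/r of this
--    cover forms with P a double star, hence lies in one monochromatic component.
-- For r ≤ 2 the majority colour class at 0 ∈ Y is anchored at 0 in all colours but one
-- ('fewColours').  For r = 3 ('threeColours') let i be the majority colour at 0 ∈ X with
-- fibre T ⊆ Y: either many x reach T in colour i (a double star at 0), or a large P ⊆ X
-- avoiding colour i towards T is uniform in a colour j at some y₀ ∈ T; then P is joined
-- in colour j to all of T, or it is anchored in the third colour too ('avoidingColour').
module Submission where

open import Defs
open import Data.Nat using (ℕ; zero; suc; _≤_; _<_; _+_; _*_; z≤n; s≤s; _≤?_)
open import Data.Nat.Properties
  using (≤-trans; ≤-reflexive; +-mono-≤; *-monoʳ-≤; *-zeroʳ; m≤m+n; m≤n+m; m+n≮n; ≰⇒>;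
         +-0-commutativeMonoid)
open import Data.Nat.Tactic.RingSolver using (solve-∀)
open import Data.Fin using (Fin; zero; suc; punchIn; punchOut; _≟_)
open import Data.Fin.Properties using (any?; all?; punchInᵢ≢i; punchOut-injective)
open import Data.Fin.Subset using (Subset; _∈_; ∣_∣)
open import Data.Vec using (tabulate)
open import Data.Vec.Properties using (lookup∘tabulate; []=⇒lookup)
open import Data.Bool using (true; if_then_else_)
open import Data.Sum using (_⊎_; inj₁; inj₂)
open import Data.Product using (Σ; _×_; ∃; ∃-syntax; _,_; proj₁; proj₂)
open import Level using (0ℓ)
open import Relation.Unary using (Pred; Decidable)
open import Relation.Nullary using (Dec; yes; no; does; ¬_; contradiction)
open import Relation.Nullary.Decidable using (_×-dec_; _→-dec_; ¬?; decidable-stable)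
open import Relation.Binary.PropositionalEquality
  using (_≡_; _≢_; refl; sym; trans; cong; subst; ≢-sym)
open import Relation.Binary.Construct.Closure.ReflexiveTransitive using (ε; _◅_)
open import Algebra.Properties.CommutativeMonoid.Sum +-0-commutativeMonoid
  using (sum; ∑-distrib-+)

indicator : {A : Set} → Dec A → ℕ
indicator (yes _) = 1
indicator (no _)  = 0

count : ∀ {n} {P : Pred (Fin n) 0ℓ} → Decidable P → ℕ
count {zero}  P? = 0
count {suc n} P? = indicator (P? zero) + count (λ x → P? (suc x))

count-none : ∀ {n} {P : Pred (Fin n) 0ℓ} (P? : Decidable P) → (∀ x → ¬ P x) → count P? ≡ 0
count-none {zero}  P? none = refl
count-none {suc n} P? none with P? zero
... | yes p = contradiction p (none zero)
... | no _  = count-none (λ x → P? (suc x)) (λ x → none (suc x))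

inhabited : ∀ k {N n} {P : Pred (Fin n) 0ℓ} (P? : Decidable P) → 1 ≤ N → N ≤ k * count P? → ∃ P
inhabited k {N} P? 1≤N N≤kc with any? P?
... | yes witness = witness
... | no nothing = contradiction (≤-trans 1≤N (subst (N ≤_) emptyCount N≤kc)) λ ()
  where
  emptyCount : k * count P? ≡ 0
  emptyCount = trans (cong (k *_) (count-none P? (λ x p → nothing (x , p)))) (*-zeroʳ k)

select : ∀ {n} {P : Pred (Fin n) 0ℓ} → Decidable P → Subset n
select P? = tabulate (λ x → does (P? x))

witness-of : {A : Set} (a? : Dec A) → does a? ≡ true → A
witness-of (yes a) _ = a

select-sound : ∀ {n} {P : Pred (Fin n) 0ℓ} (P? : Decidable P) {x} → x ∈ select P? → P x
select-sound P? {x} x∈ =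
  witness-of (P? x) (trans (sym (lookup∘tabulate (λ z → does (P? z)) x)) ([]=⇒lookup x∈))

∣select∣ : ∀ {n} {P : Pred (Fin n) 0ℓ} (P? : Decidable P) → ∣ select P? ∣ ≡ count P?
∣select∣ {zero}  P? = refl
∣select∣ {suc n} P? with P? zero
... | yes _ = cong suc (∣select∣ (λ x → P? (suc x)))
... | no _  = ∣select∣ (λ x → P? (suc x))

≤-sum : ∀ {k} (f : Fin k → ℕ) i → f i ≤ sum f
≤-sum f zero    = m≤m+n _ _
≤-sum f (suc i) = ≤-trans (≤-sum (λ x → f (suc x)) i) (m≤n+m _ _)

sum-strict-bound : ∀ {j} k N (a : Fin j → ℕ) → (∀ i → k * a i < N) → j + k * sum a ≤ j * N
sum-strict-bound {zero}  k N a _     = ≤-reflexive (*-zeroʳ k)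
sum-strict-bound {suc j} k N a bound =
  subst (_≤ N + j * N) (regroup k j (a zero) (sum (λ i → a (suc i))))
    (+-mono-≤ (bound zero) (sum-strict-bound k N (λ i → a (suc i)) (λ i → bound (suc i))))
  where
  regroup : ∀ k j a₀ s → suc (k * a₀) + (j + k * s) ≡ suc j + k * (a₀ + s)
  regroup = solve-∀

pigeonhole : ∀ {r} N (a : Fin (suc r) → ℕ) → N ≤ sum a → ∃[ i ] N ≤ suc r * a i
pigeonhole {r} N a N≤Σa with any? (λ i → N ≤? suc r * a i)
... | yes found = found
... | no none   = contradiction tooLarge (m+n≮n r (suc r * sum a))
  where
  tooLarge : suc r + suc r * sum a ≤ suc r * sum a
  tooLarge = ≤-trans (sum-strict-bound (suc r) N a (λ i → ≰⇒> (λ h → none (i , h))))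
                     (*-monoʳ-≤ (suc r) N≤Σa)

count-cover : ∀ {k n} {P : Fin k → Pred (Fin n) 0ℓ} (P? : ∀ i → Decidable (P i)) →
  (∀ x → ∃[ i ] P i x) → n ≤ sum (λ i → count (P? i))
count-cover {n = zero}  P? cover = z≤n
count-cover {k} {suc n} P? cover =
  subst (suc n ≤_) (sym (∑-distrib-+ heads tails))
    (+-mono-≤ headHit (count-cover (λ i x → P? i (suc x)) (λ x → cover (suc x))))
  where
  heads tails : Fin k → ℕ
  heads i = indicator (P? i zero)
  tails i = count (λ x → P? i (suc x))
  headHit : 1 ≤ sum heads
  headHit with cover zero
  ... | i , p = ≤-trans (indicatorHolds (P? i zero) p) (≤-sum heads i)
    where
    indicatorHolds : {A : Set} (a? : Dec A) → A → 1 ≤ indicator a?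
    indicatorHolds (yes _) _ = s≤s z≤n
    indicatorHolds (no ¬a) a = contradiction a ¬a

large-class : ∀ {r n} {P : Fin (suc r) → Pred (Fin n) 0ℓ} (P? : ∀ i → Decidable (P i)) →
  (∀ x → ∃[ i ] P i x) → ∃[ i ] n ≤ suc r * count (P? i)
large-class P? cover = pigeonhole _ (λ i → count (P? i)) (count-cover P? cover)

large-fibre : ∀ {r n} (f : Fin n → Fin (suc r)) → ∃[ i ] n ≤ suc r * count (λ x → f x ≟ i)
large-fibre f = large-class (λ i x → f x ≟ i) (λ x → f x , refl)

two-unique : {j u v : Fin 2} → u ≢ j → v ≢ j → u ≡ v
two-unique {zero}     {zero}     u≢j _   = contradiction refl u≢j
two-unique {zero}     {suc zero} {zero}     _ v≢j = contradiction refl v≢j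
two-unique {zero}     {suc zero} {suc zero} _ _   = refl
two-unique {suc zero} {zero}     {zero}     _ _   = refl
two-unique {suc zero} {zero}     {suc zero} _ v≢j = contradiction refl v≢j
two-unique {suc zero} {suc zero} u≢j _   = contradiction refl u≢j

-- Two elements of Fin 3 avoiding the same two distinct values coincide: removing i
-- (by punchOut) reduces this to Fin 2.
third-unique : {i j u v : Fin 3} → i ≢ j → u ≢ i → u ≢ j → v ≢ i → v ≢ j → u ≡ v
third-unique {i} {j} i≢j u≢i u≢j v≢i v≢j =
  punchOut-injective (≢-sym u≢i) (≢-sym v≢i)
    (two-unique (avoid u≢i u≢j) (avoid v≢i v≢j))
  where
  avoid : ∀ {w} (w≢i : w ≢ i) → w ≢ j → punchOut (≢-sym w≢i) ≢ punchOut i≢j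
  avoid w≢i w≢j eq = w≢j (punchOut-injective (≢-sym w≢i) i≢j eq)

if-dec : ∀ {A : Set} {k} (d : Dec A) {a b ℓ : Fin k} →
  (if does d then a else b) ≡ ℓ → (A × a ≡ ℓ) ⊎ (¬ A × b ≡ ℓ)
if-dec (yes p) eq = inj₁ (p , eq)
if-dec (no ¬p) eq = inj₂ (¬p , eq)

LargeComponent : (r m n : ℕ) → Coloring r m n → Set
LargeComponent r m n c = ∃[ i ] ∃[ v ] Σ (Subset m) λ S → Σ (Subset n) λ T →
    (∀ x → x ∈ S → SameComp c i v (inj₁ x)) ×
    (∀ y → y ∈ T → SameComp c i v (inj₂ y)) ×
    m ≤ r * ∣ S ∣ × n ≤ r * ∣ T ∣

component : ∀ {r m n} (c : Coloring r m n) i v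
  {S : Pred (Fin m) 0ℓ} {T : Pred (Fin n) 0ℓ} (S? : Decidable S) (T? : Decidable T) →
  (∀ x → S x → SameComp c i v (inj₁ x)) → (∀ y → T y → SameComp c i v (inj₂ y)) →
  m ≤ r * count S? → n ≤ r * count T? → LargeComponent r m n c
component {r} c i v S? T? reachS reachT largeS largeT =
  i , v , select S? , select T? ,
  (λ x x∈S → reachS x (select-sound S? x∈S)) ,
  (λ y y∈T → reachT y (select-sound T? y∈T)) ,
  subst (λ k → _ ≤ r * k) (sym (∣select∣ S?)) largeS ,
  subst (λ k → _ ≤ r * k) (sym (∣select∣ T?)) largeT

doubleStarX : ∀ {r m n} (c : Coloring r m n) i (x₀ : Fin m)
  {S : Pred (Fin m) 0ℓ} {T : Pred (Fin n) 0ℓ} (S? : Decidable S) (T? : Decidable T) →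
  (∀ y → T y → c x₀ y ≡ i) → (∀ x → S x → ∃[ y ] T y × c x y ≡ i) →
  m ≤ r * count S? → n ≤ r * count T? → LargeComponent r m n c
doubleStarX c i x₀ S? T? toCentre toT =
  component c i (inj₁ x₀) S? T?
    (λ x Sx → let (y , Ty , xy≡i) = toT x Sx in xy x₀ y (toCentre y Ty) ◅ yx x y xy≡i ◅ ε)
    (λ y Ty → xy x₀ y (toCentre y Ty) ◅ ε)

doubleStarY : ∀ {r m n} (c : Coloring r m n) i (y₀ : Fin n)
  {S : Pred (Fin m) 0ℓ} {T : Pred (Fin n) 0ℓ} (S? : Decidable S) (T? : Decidable T) →
  (∀ x → S x → c x y₀ ≡ i) → (∀ y → T y → ∃[ x ] S x × c x y ≡ i) →
  m ≤ r * count S? → n ≤ r * count T? → LargeComponent r m n c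
doubleStarY c i y₀ S? T? toCentre toS =
  component c i (inj₂ y₀) S? T?
    (λ x Sx → yx x y₀ (toCentre x Sx) ◅ ε)
    (λ y Ty → let (x , Sx , xy≡i) = toS y Ty in yx x y₀ (toCentre x Sx) ◅ xy x y xy≡i ◅ ε)

Hit : ∀ {r m n} → Coloring r m n → Pred (Fin m) 0ℓ → Fin r → Pred (Fin n) 0ℓ
Hit c P ℓ y = ∃[ a ] P a × c a y ≡ ℓ

Uniform : ∀ {r m n} → Coloring r m n → Pred (Fin m) 0ℓ → Fin r → Pred (Fin n) 0ℓ
Uniform c P ℓ y = ∀ a → P a → c a y ≡ ℓ

hit? : ∀ {r m n} (c : Coloring r m n) {P} → Decidable P → ∀ ℓ → Decidable (Hit c P ℓ)
hit? c P? ℓ y = any? (λ a → P? a ×-dec (c a y ≟ ℓ))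

uniform? : ∀ {r m n} (c : Coloring r m n) {P} → Decidable P → ∀ ℓ → Decidable (Uniform c P ℓ)
uniform? c P? ℓ y = all? (λ a → P? a →-dec (c a y ≟ ℓ))

-- The colour-ℓ class consists of the y
-- hit from P in colour ℓ, required to be uniform when ℓ = u; these classes cover Y, and a
-- large class is the outer layer of a double star centred at the anchor of ℓ (ℓ ≢ u) or
-- at any vertex of the class (ℓ = u).
anchored : ∀ {r m n} (c : Coloring (suc r) m n) {P : Pred (Fin m) 0ℓ} (P? : Decidable P)
  (u : Fin (suc r)) → (∀ ℓ → ℓ ≢ u → ∃ (Uniform c P ℓ)) →
  1 ≤ m → 1 ≤ n → m ≤ suc r * count P? → LargeComponent (suc r) m n c
anchored {r} {m} {n} c {P} P? u anchor 1≤m 1≤n largeP =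
  let (ℓ , largeClass) = large-class class? cover
      (y₀ , uniformAtCentre) = centre ℓ (inhabited (suc r) (class? ℓ) 1≤n largeClass)
  in doubleStarY c ℓ y₀ P? (class? ℓ) uniformAtCentre (λ y → proj₁) largeP largeClass
  where
  Class : Fin (suc r) → Pred (Fin n) 0ℓ
  Class ℓ y = Hit c P ℓ y × (ℓ ≡ u → Uniform c P u y)

  class? : ∀ ℓ → Decidable (Class ℓ)
  class? ℓ y = hit? c P? ℓ y ×-dec ((ℓ ≟ u) →-dec uniform? c P? u y)

  cover : ∀ y → ∃[ ℓ ] Class ℓ y
  cover y with any? (λ a → P? a ×-dec ¬? (c a y ≟ u))
  ... | yes (a , Pa , ay≢u) = c a y , (a , Pa , refl) , λ ay≡u → contradiction ay≡u ay≢u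
  ... | no  allU            =
    let (a₀ , Pa₀) = inhabited (suc r) P? 1≤m largeP in
    u , (a₀ , Pa₀ , uniform a₀ Pa₀) , λ _ → uniform
    where
    uniform : Uniform c P u y
    uniform a Pa = decidable-stable (c a y ≟ u) (λ ay≢u → allU (a , Pa , ay≢u))

  centre : ∀ ℓ → ∃ (Class ℓ) → ∃ (Uniform c P ℓ)
  centre ℓ (t , _ , uniformIfU) with ℓ ≟ u
  ... | no ℓ≢u  = anchor ℓ ℓ≢u
  ... | yes refl = t , uniformIfU refl

-- If every colour j has a partner u such that every colour other than u equals j, the
-- majority colour class at the vertex 0 ∈ Y is anchored at 0 in every colour but u.
fewColours : ∀ {r m n} → (∀ (j : Fin (suc r)) → ∃[ u ] ∀ ℓ → ℓ ≢ u → ℓ ≡ j) →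
  (c : Coloring (suc r) m (suc n)) → 1 ≤ m → LargeComponent (suc r) m (suc n) c
fewColours partner c 1≤m =
  let (j , largeP) = large-fibre (λ x → c x zero)
      (u , others≡j) = partner j
  in anchored c (λ x → c x zero ≟ j) u
       (λ ℓ ℓ≢u → zero , λ a a0≡j → trans a0≡j (sym (others≡j ℓ ℓ≢u)))
       1≤m (s≤s z≤n) largeP

-- One and two colours have partners (for two: the other colour).
partner₁ : ∀ (j : Fin 1) → ∃[ u ] ∀ ℓ → ℓ ≢ u → ℓ ≡ j
partner₁ zero = zero , λ { zero _ → refl }

partner₂ : ∀ (j : Fin 2) → ∃[ u ] ∀ ℓ → ℓ ≢ u → ℓ ≡ j
partner₂ j = punchIn j zero , λ ℓ ℓ≢u → two-unique ℓ≢u (≢-sym (punchInᵢ≢i j zero))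

-- Either every vertex of T is hit from P in colour j (a double star at y₀), or
-- some b ∈ T is not, and then P is uniform at b in the third colour, so P is anchored in
-- every colour except i.
avoidingColour : ∀ {m n} (c : Coloring 3 m n) (i j : Fin 3) (y₀ : Fin n)
  {P : Pred (Fin m) 0ℓ} {T : Pred (Fin n) 0ℓ} (P? : Decidable P) (T? : Decidable T) →
  j ≢ i → Uniform c P j y₀ → (∀ a b → P a → T b → c a b ≢ i) →
  1 ≤ m → 1 ≤ n → m ≤ 3 * count P? → n ≤ 3 * count T? → LargeComponent 3 m n c
avoidingColour c i j y₀ {P} P? T? j≢i uniformAtY₀ noEdgeᵢ 1≤m 1≤n largeP largeT
  with any? (λ y → T? y ×-dec ¬? (hit? c P? j y))
... | no allHit =
  doubleStarY c j y₀ P? T? uniformAtY₀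
    (λ y Ty → decidable-stable (hit? c P? j y) (λ notHit → allHit (y , Ty , notHit)))
    largeP largeT
... | yes (b , Tb , notHit) = anchored c P? i anchorAt 1≤m 1≤n largeP
  where
  anchorAt : ∀ ℓ → ℓ ≢ i → ∃ (Uniform c P ℓ)
  anchorAt ℓ ℓ≢i with ℓ ≟ j
  ... | yes refl = y₀ , uniformAtY₀
  ... | no ℓ≢j   = b , λ a Pa →
    third-unique (≢-sym j≢i) (noEdgeᵢ a b Pa Tb) (λ ab≡j → notHit (a , Pa , ab≡j)) ℓ≢i ℓ≢j

-- A large
-- label class is a double star at 0 (label i) or avoids colour i towards T (other labels).
module MajorityColour {m n} (c : Coloring 3 (suc m) n) (1≤n : 1 ≤ n)
  (i : Fin 3) (largeT : n ≤ 3 * count (λ y → c zero y ≟ i)) where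

  T? : Decidable (λ y → c zero y ≡ i)
  T? y = c zero y ≟ i

  centreInT : ∃ (λ y → c zero y ≡ i)
  centreInT = inhabited 3 T? 1≤n largeT

  y₀ : Fin n
  y₀ = proj₁ centreInT

  Reach : Pred (Fin (suc m)) 0ℓ
  Reach x = ∃[ y ] c zero y ≡ i × c x y ≡ i

  reach? : Decidable Reach
  reach? x = any? (λ y → T? y ×-dec (c x y ≟ i))

  label : Fin (suc m) → Fin 3
  label x = if does (reach? x) then i else c x y₀

  labelledᵢ : ∀ x → label x ≡ i → Reach x
  labelledᵢ x eq with if-dec (reach? x) eq
  ... | inj₁ (reach , _) = reach
  ... | inj₂ (_ , xy₀≡i) = y₀ , proj₂ centreInT , xy₀≡i

  labelledOther : ∀ {ℓ} x → ℓ ≢ i → label x ≡ ℓ → ¬ Reach x × c x y₀ ≡ ℓ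
  labelledOther x ℓ≢i eq with if-dec (reach? x) eq
  ... | inj₁ (_ , i≡ℓ) = contradiction (sym i≡ℓ) ℓ≢i
  ... | inj₂ unreached = unreached

  fromLabelClass : ∃[ ℓ ] suc m ≤ 3 * count (λ x → label x ≟ ℓ) → LargeComponent 3 (suc m) n c
  fromLabelClass (ℓ , largeP) with ℓ ≟ i
  ... | yes refl = doubleStarX c i zero (λ x → label x ≟ i) T? (λ y Ty → Ty) labelledᵢ largeP largeT
  ... | no ℓ≢i   =
    avoidingColour c i ℓ y₀ (λ x → label x ≟ ℓ) T? ℓ≢i
      (λ x labelℓ → proj₂ (labelledOther x ℓ≢i labelℓ))
      (λ x y labelℓ Ty xy≡i → proj₁ (labelledOther x ℓ≢i labelℓ) (y , Ty , xy≡i))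
      (s≤s z≤n) 1≤n largeP largeT

  result : LargeComponent 3 (suc m) n c
  result = fromLabelClass (large-fibre label)

threeColours : ∀ {m n} (c : Coloring 3 (suc m) n) → 1 ≤ n → LargeComponent 3 (suc m) n c
threeColours c 1≤n =
  let (i , largeT) = large-fibre (c zero) in MajorityColour.result c 1≤n i largeT

theorem3 : (r m n : ℕ) → 1 ≤ r → r ≤ 3 → 1 ≤ m → 1 ≤ n →
    (c : Coloring r m n) →
    ∃[ i ] ∃[ v ] Σ (Subset m) λ S → Σ (Subset n) λ T →
      (∀ x → x ∈ S → SameComp c i v (inj₁ x)) ×
      (∀ y → y ∈ T → SameComp c i v (inj₂ y)) ×
      m ≤ r * ∣ S ∣ × n ≤ r * ∣ T ∣
theorem3 1 m (suc n) _ _ 1≤m _ c = fewColours partner₁ c 1≤m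
theorem3 2 m (suc n) _ _ 1≤m _ c = fewColours partner₂ c 1≤m
theorem3 3 (suc m) n _ _ _ 1≤n c = threeColours c 1≤n
theorem3 (suc (suc (suc (suc _)))) _ _ _ (s≤s (s≤s (s≤s ()))) _ _ _
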